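{- Let $q\ge3$ (even or odd) and let $\mathbf f\in A_q^+$ be a forbidden factor whose last symbol is $q-1$ and which does not induce zero periodicity on $A_q^\infty$. Let $\mathbf p\in A_q^*(\mathbf f)$ be such that one of the first or the last word of $\mathbf p|A_q^\infty(\mathbf f)$, with respect to the appropriate order, does not have ultimate period $0$, and let $\mathbf a$ be this word. Then $\mathbf a=\mathbf p(q-2)^\infty$.
   Context: $A_q=\{0,1,\dots,q-1\}$. $A_q^*$ (resp. $A_q^+$) is the set of all (resp. nonempty) finite words, $A_q^\infty$ the right-infinite words; $\mathbf a^\infty=\mathbf a\mathbf a\cdots$. For a set $X$ of words, $X(\mathbf f)$ is the set of words of $X$ not containing $\mathbf f$ as a factor (contiguous subword), $\mathbf p|X$ the words of $X$ with prefix $\mathbf p$. An infinite word has ultimate period $\mathbf c\ne\epsilon$ if it equals $\mathbf b\mathbf c^\infty$ for a finite $\mathbf b$. For distinct words $\mathbf s,\mathbf t$ of the same (finite or infinite) length, with $k$ the leftmost differing position, $u=\sum_{i<k}s_i$, $v$ the number of nonzero symbols among $s_1,\dots,s_{k-1}$: $\mathbf s\prec\mathbf t$ iff ($u$ even and $s_k<t_k$) or ($u$ odd and $s_k>t_k$); $\mathbf s\triangleleft\mathbf t$ iff ($u+v$ even and $s_k<t_k$) or ($u+v$ odd and $s_k>t_k$). The appropriate order is $\prec$ for even $q$ and $\triangleleft$ for odd $q$; first/last mean least/greatest in it. $\mathbf f$ induces zero periodicity on $A_q^\infty$ if for every $\mathbf p\in A_q^*(\mathbf f)$ the first and last words of $\mathbf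 p|A_q^\infty(\mathbf f)$ both have ultimate period $0$. -}

module Defs where

open import Data.Nat using (ℕ; zero; suc; _+_; _≤_; _<_; _∸_)
open import Data.Fin as Fin using (Fin; toℕ)
open import Data.List using (List; []; _∷_; _++_; map; upTo; length; [_])
open import Data.Nat.ListAction using (sum)
open import Data.Bool using (Bool; true; false; if_then_else_)
open import Data.Product using (Σ; ∃; _×_; _,_)
open import Data.Sum using (_⊎_)
open import Relation.Nullary using (¬_)
open import Relation.Binary.PropositionalEquality using (_≡_)

Word : ℕ → Set
Word q = List (Fin q)

InfWord : ℕ → Set
InfWord q = ℕ → Fin q

pref : ∀ {q} → InfWord q → ℕ → Word q
pref w n = map w (upTo n)

Factor : ∀ {q} → Word q → Word q → Set
Factor {q} f x = Σ (Word q) λ l → Σ (Word q) λ r → l ++ f ++ r ≡ x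

FactorInf : ∀ {q} → Word q → InfWord q → Set
FactorInf f w = ∃ λ n → Factor f (pref w n)

AvoidsFin : ∀ {q} → Word q → Word q → Set
AvoidsFin f x = ¬ Factor f x

AvoidsInf : ∀ {q} → Word q → InfWord q → Set
AvoidsInf f w = ¬ FactorInf f w

HasPrefix : ∀ {q} → Word q → InfWord q → Set
HasPrefix p w = pref w (length p) ≡ p

InPF : ∀ {q} → Word q → Word q → InfWord q → Set
InPF f p w = HasPrefix p w × AvoidsInf f w

evenb : ℕ → Bool
evenb zero = true
evenb (suc n) = if evenb n then false else true

nonzeros : ∀ {q} → Word q → ℕ
nonzeros [] = 0
nonzeros (Fin.zero ∷ xs) = nonzeros xs
nonzeros (Fin.suc _ ∷ xs) = suc (nonzeros xs)

symsum : ∀ {q} → Word q → ℕ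
symsum x = sum (map toℕ x)

CmpAt : ∀ {q} → ℕ → Fin q → Fin q → Set
CmpAt n x y = if evenb n then (x Fin.< y) else (y Fin.< x)

-- s ≺ t : k is the first differing position (0-based), u = sum of s_0..s_{k-1}
Prec : ∀ {q} → InfWord q → InfWord q → Set
Prec s t = ∃ λ k → (∀ i → i < k → s i ≡ t i)
                 × CmpAt (symsum (pref s k)) (s k) (t k)

-- s ◁ t : same with u + v, v = number of nonzero symbols among s_0..s_{k-1}
Tri : ∀ {q} → InfWord q → InfWord q → Set
Tri s t = ∃ λ k → (∀ i → i < k → s i ≡ t i)
                × CmpAt (symsum (pref s k) + nonzeros (pref s k)) (s k) (t k)

AppLess : ∀ q → InfWord q → InfWord q → Set
AppLess q = if evenb q then Prec else Tri

_≐_ : ∀ {q} → InfWord q → InfWord q → Set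
s ≐ t = ∀ i → s i ≡ t i

IsFirst : ∀ q → (InfWord q → Set) → InfWord q → Set
IsFirst q S a = S a × (∀ b → S b → (a ≐ b) ⊎ AppLess q a b)

IsLast : ∀ q → (InfWord q → Set) → InfWord q → Set
IsLast q S a = S a × (∀ b → S b → (a ≐ b) ⊎ AppLess q b a)

UltPeriod0 : ∀ {q} → InfWord q → Set
UltPeriod0 a = ∃ λ n → ∀ i → n ≤ i → toℕ (a i) ≡ 0

InducesZeroPeriodicity : ∀ q → Word q → Set
InducesZeroPeriodicity q f =
  ∀ (p : Word q) → AvoidsFin f p → ∀ (a : InfWord q) →
    (IsFirst q (InPF f p) a → UltPeriod0 a) × (IsLast q (InPF f p) a → UltPeriod0 a)

EndsWithTop : ∀ q → Word q → Set
EndsWithTop q f = Σ (Word q) λ g → Σ (Fin q) λ x → (f ≡ g ++ [ x ]) × (toℕ x ≡ q ∸ 1)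

-- Both appropriate orders are alternating lexicographic orders: two words are
-- compared at their first difference k, and the direction of the comparison is
-- governed by the parity of a weight g of the common prefix of length k, where
-- g is additive (g (xs ++ [ x ]) = g xs + wt x) with wt 0 = 0 and wt (q-1) odd.
-- For ≺ the weight is the symbol sum, for ◁ it is symbol sum plus number of
-- nonzero symbols.
--
-- Let a be extremal (least or greatest) in p | A^∞(f) and not ultimately 0.
-- Replacing the tail of a after position m ≥ |p| by c 0^∞, with c ≠ q-1, keeps
-- the word in p | A^∞(f), because f can only end at a symbol q-1.  Comparing a
-- with a[0,m) 0^∞ shows that the prefix parity of a at every m ≥ |p| is the
-- "wrong" one for extremality; hence no tail symbol is q-1 (it would flip the
-- parity).  Comparing a with a[0,i) (q-2) 0^∞ then forces a i = q-2.
-- The theorem follows by splitting on the parity of q to pick the weight.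

module Submission where

open import Defs
open import Data.Nat using (ℕ; _≤_; _∸_)
open import Data.Fin using (toℕ)
open import Data.List using (length)
open import Data.Product using (_×_)
open import Data.Sum using (_⊎_)
open import Relation.Nullary using (¬_)
open import Relation.Binary.PropositionalEquality using (_≡_)

open import Data.Nat using (zero; suc; _+_; _<_; z≤n; s≤s; s≤s⁻¹; _<?_)
open import Data.Nat.Properties
open import Data.Fin as Fin using (Fin)
import Data.Fin.Properties as Finₚ
open import Data.List using ([]; _∷_; _++_; map; applyUpTo; [_])
open import Data.List.Properties using (map-upTo; applyUpTo-∷ʳ; map-++; ++-assoc; ∷-injective; ++-identityʳ)
open import Data.Nat.ListAction using (sum)
open import Data.Nat.ListAction.Properties using (sum-++)
open import Data.Bool using (Bool; true; false; not)
open import Data.Bool.Properties using (not-involutive; not-¬)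
open import Data.Product using (∃; _,_; proj₁; proj₂)
open import Data.Sum using (inj₁; inj₂)
open import Data.Empty using (⊥-elim)
open import Relation.Binary using (tri<; tri≈; tri>)
open import Relation.Binary.PropositionalEquality using (refl; sym; trans; cong; cong₂; subst; module ≡-Reasoning)
open import Relation.Nullary using (yes; no)
open import Algebra.Properties.CommutativeSemigroup +-commutativeSemigroup using (interchange)

open ≡-Reasoning

pref-applyUpTo : ∀ {q} (s : InfWord q) n → pref s n ≡ applyUpTo s n
pref-applyUpTo = map-upTo

pref-suc : ∀ {q} (s : InfWord q) n → pref s (suc n) ≡ pref s n ++ [ s n ]
pref-suc s n = begin
  pref s (suc n)             ≡⟨ pref-applyUpTo s (suc n) ⟩
  applyUpTo s (suc n)        ≡⟨ applyUpTo-∷ʳ s n ⟨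
  applyUpTo s n ++ [ s n ]   ≡⟨ cong (_++ [ s n ]) (pref-applyUpTo s n) ⟨
  pref s n ++ [ s n ]        ∎

pref-cong : ∀ {q} (s t : InfWord q) n → (∀ i → i < n → s i ≡ t i) → pref s n ≡ pref t n
pref-cong s t zero agree = refl
pref-cong s t (suc n) agree = begin
  pref s (suc n)          ≡⟨ pref-suc s n ⟩
  pref s n ++ [ s n ]     ≡⟨ cong₂ (λ u v → u ++ [ v ])
                               (pref-cong s t n (λ i i<n → agree i (m<n⇒m<1+n i<n)))
                               (agree n (n<1+n n)) ⟩
  pref t n ++ [ t n ]     ≡⟨ pref-suc t n ⟨
  pref t (suc n)          ∎

applyUpTo-split : ∀ {A : Set} (s : ℕ → A) n xs y ys → xs ++ y ∷ ys ≡ applyUpTo s n →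
  applyUpTo s (length xs) ≡ xs × s (length xs) ≡ y
applyUpTo-split s zero [] y ys ()
applyUpTo-split s zero (x ∷ xs) y ys ()
applyUpTo-split s (suc n) [] y ys refl = refl , refl
applyUpTo-split s (suc n) (x ∷ xs) y ys eq with ∷-injective eq
... | x≡s0 , rest with applyUpTo-split (λ k → s (suc k)) n xs y ys rest
...   | prefix , at = cong₂ _∷_ (sym x≡s0) prefix , at

occurrence-end : ∀ {q} (b : InfWord q) n (w : Word q) x → Factor (w ++ [ x ]) (pref b n) →
  ∃ λ j → b j ≡ x × Factor (w ++ [ x ]) (pref b (suc j))
occurrence-end b n w x (l , rest , eq) = length (l ++ w) , proj₂ split , l , [] , occurrence
  where
  shape : (l ++ w) ++ x ∷ rest ≡ applyUpTo b n
  shape = begin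
    (l ++ w) ++ x ∷ rest        ≡⟨ ++-assoc l w (x ∷ rest) ⟩
    l ++ w ++ [ x ] ++ rest     ≡⟨ cong (l ++_) (++-assoc w [ x ] rest) ⟨
    l ++ (w ++ [ x ]) ++ rest   ≡⟨ eq ⟩
    pref b n                    ≡⟨ pref-applyUpTo b n ⟩
    applyUpTo b n               ∎
  split = applyUpTo-split b n (l ++ w) x rest shape
  j = length (l ++ w)
  occurrence : l ++ (w ++ [ x ]) ++ [] ≡ pref b (suc j)
  occurrence = begin
    l ++ (w ++ [ x ]) ++ []     ≡⟨ cong (l ++_) (++-identityʳ (w ++ [ x ])) ⟩
    l ++ w ++ [ x ]             ≡⟨ ++-assoc l w [ x ] ⟨
    (l ++ w) ++ [ x ]           ≡⟨ cong₂ (λ u v → u ++ [ v ])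
                                     (sym (trans (pref-applyUpTo b j) (proj₁ split)))
                                     (sym (proj₂ split)) ⟩
    pref b j ++ [ b j ]         ≡⟨ pref-suc b j ⟨
    pref b (suc j)              ∎

-- Avoidance transfers along agreement on [0, m) when f ends with q-1 and the
-- new word has no symbol q-1 from position m on: every occurrence of f in b
-- ends below m, where b coincides with a.
avoids-transfer : ∀ {q} (f : Word q) (a b : InfWord q) m → EndsWithTop q f → AvoidsInf f a →
  (∀ j → j < m → b j ≡ a j) → (∀ j → m ≤ j → ¬ toℕ (b j) ≡ q ∸ 1) → AvoidsInf f b
avoids-transfer f a b m (w , x , refl , x-top) a-avoids agree no-top (n , occ)
  with occurrence-end b n w x occ
... | j , bj≡x , occ-j with j <? m
...   | no j≮m = no-top j (≮⇒≥ j≮m) (trans (cong toℕ bj≡x) x-top)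
...   | yes j<m = a-avoids (suc j , subst (Factor f) same-prefix occ-j)
  where
  same-prefix : pref b (suc j) ≡ pref a (suc j)
  same-prefix = pref-cong b a (suc j) (λ i i≤j → agree i (≤-<-trans (s≤s⁻¹ i≤j) j<m))

-- splice a m c is the word a[0,m) c 0^∞, the competitor compared with a.
splice : ∀ {n} → InfWord (suc n) → ℕ → Fin (suc n) → InfWord (suc n)
splice a m c j with <-cmp j m
... | tri< _ _ _ = a j
... | tri≈ _ _ _ = c
... | tri> _ _ _ = Fin.zero

splice-below : ∀ {n} (a : InfWord (suc n)) m c j → j < m → splice a m c j ≡ a j
splice-below a m c j j<m with <-cmp j m
... | tri< _ _ _ = refl
... | tri≈ j≮m _ _ = ⊥-elim (j≮m j<m)
... | tri> j≮m _ _ = ⊥-elim (j≮m j<m)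

splice-at : ∀ {n} (a : InfWord (suc n)) m c → splice a m c m ≡ c
splice-at a m c with <-cmp m m
... | tri< _ m≢m _ = ⊥-elim (m≢m refl)
... | tri≈ _ _ _ = refl
... | tri> _ m≢m _ = ⊥-elim (m≢m refl)

splice-above : ∀ {n} (a : InfWord (suc n)) m c j → m < j → splice a m c j ≡ Fin.zero
splice-above a m c j m<j with <-cmp j m
... | tri< j<m _ _ = ⊥-elim (<-asym j<m m<j)
... | tri≈ _ j≡m _ = ⊥-elim (<-irrefl (sym j≡m) m<j)
... | tri> _ _ _ = refl

splice-ultimately-zero : ∀ {n} (a : InfWord (suc n)) m c → UltPeriod0 (splice a m c)
splice-ultimately-zero a m c = suc m , λ j m<j → cong toℕ (splice-above a m c j m<j)

≐-ultimately-zero : ∀ {q} {a b : InfWord q} → a ≐ b → UltPeriod0 b → UltPeriod0 a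
≐-ultimately-zero a≐b (n , zeros) = n , λ j n≤j → trans (cong toℕ (a≐b j)) (zeros j n≤j)

truncate-zero : ∀ {n} (a : InfWord (suc n)) m j → m ≤ j → splice a m Fin.zero j ≡ Fin.zero
truncate-zero a m j m≤j with m≤n⇒m<n∨m≡n m≤j
... | inj₁ m<j = splice-above a m Fin.zero j m<j
... | inj₂ refl = splice-at a m Fin.zero

evenb-suc : ∀ n → evenb (suc n) ≡ not (evenb n)
evenb-suc n with evenb n
... | true = refl
... | false = refl

evenb-+-odd : ∀ m w → evenb w ≡ false → evenb (m + w) ≡ not (evenb m)
evenb-+-odd zero w w-odd = w-odd
evenb-+-odd (suc m) w w-odd = begin
  evenb (suc (m + w))     ≡⟨ evenb-suc (m + w) ⟩
  not (evenb (m + w))     ≡⟨ cong not (evenb-+-odd m w w-odd) ⟩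
  not (not (evenb m))     ≡⟨ cong not (evenb-suc m) ⟨
  not (evenb (suc m))     ∎

bool-split : ∀ (b d : Bool) → b ≡ d ⊎ b ≡ not d
bool-split true true = inj₁ refl
bool-split true false = inj₂ refl
bool-split false true = inj₂ refl
bool-split false false = inj₁ refl

-- Prec is AltLex symsum and Tri is AltLex (symsum + nonzeros), definitionally.
AltLex : ∀ {q} → (Word q → ℕ) → InfWord q → InfWord q → Set
AltLex g s t = ∃ λ k → (∀ i → i < k → s i ≡ t i) × CmpAt (g (pref s k)) (s k) (t k)

cmpAt-view : ∀ {q} n (x y : Fin q) → CmpAt n x y →
  (evenb n ≡ true → x Fin.< y) × (evenb n ≡ false → y Fin.< x)
cmpAt-view n x y cmp with evenb n
... | true = (λ _ → cmp) , (λ ())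
... | false = (λ ()) , (λ _ → cmp)

-- The general argument, for an additive weight with wt 0 = 0 and wt (q-1) odd,
-- over the alphabet of size Q = 2 + r (so r is the value q-2).
module ExtremalWords (r : ℕ) (g : Word (2 + r) → ℕ) (wt : Fin (2 + r) → ℕ)
  (g-snoc : ∀ xs x → g (xs ++ [ x ]) ≡ g xs + wt x)
  (wt-zero : wt Fin.zero ≡ 0)
  (wt-top : ∀ x → toℕ x ≡ suc r → evenb (wt x) ≡ false) where

  Q : ℕ
  Q = 2 + r

  parity : InfWord Q → ℕ → Bool
  parity a k = evenb (g (pref a k))

  weight-zeros : ∀ (a : InfWord Q) m k → m ≤ k → (∀ j → m ≤ j → j < k → a j ≡ Fin.zero) →
    g (pref a k) ≡ g (pref a m)
  weight-zeros a m zero z≤n zeros = refl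
  weight-zeros a m (suc k) m≤k+1 zeros with m≤n⇒m<n∨m≡n m≤k+1
  ... | inj₂ refl = refl
  ... | inj₁ m<k+1 = begin
    g (pref a (suc k))          ≡⟨ cong g (pref-suc a k) ⟩
    g (pref a k ++ [ a k ])     ≡⟨ g-snoc (pref a k) (a k) ⟩
    g (pref a k) + wt (a k)     ≡⟨ cong (λ x → g (pref a k) + wt x) (zeros k m≤k (n<1+n k)) ⟩
    g (pref a k) + wt Fin.zero  ≡⟨ cong (g (pref a k) +_) wt-zero ⟩
    g (pref a k) + 0            ≡⟨ +-identityʳ _ ⟩
    g (pref a k)                ≡⟨ weight-zeros a m k m≤k (λ j m≤j j<k → zeros j m≤j (m<n⇒m<1+n j<k)) ⟩
    g (pref a m)                ∎
    where m≤k = s≤s⁻¹ m<k+1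

  parity-top : ∀ (a : InfWord Q) k → toℕ (a k) ≡ suc r → parity a (suc k) ≡ not (parity a k)
  parity-top a k top = begin
    evenb (g (pref a (suc k)))          ≡⟨ cong (λ w → evenb (g w)) (pref-suc a k) ⟩
    evenb (g (pref a k ++ [ a k ]))     ≡⟨ cong evenb (g-snoc (pref a k) (a k)) ⟩
    evenb (g (pref a k) + wt (a k))     ≡⟨ evenb-+-odd (g (pref a k)) (wt (a k)) (wt-top (a k) top) ⟩
    not (parity a k)                    ∎

  Extremal : Bool → (InfWord Q → Set) → InfWord Q → Set
  Extremal true S a = S a × (∀ b → S b → (a ≐ b) ⊎ AltLex g a b)
  Extremal false S a = S a × (∀ b → S b → (a ≐ b) ⊎ AltLex g b a)

  extremal-member : ∀ dir S a → Extremal dir S a → S a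
  extremal-member true S a = proj₁
  extremal-member false S a = proj₁

  Beyond : Bool → InfWord Q → InfWord Q → Set
  Beyond dir a b = ∃ λ k → (∀ i → i < k → a i ≡ b i) ×
    (parity a k ≡ dir → a k Fin.< b k) × (parity a k ≡ not dir → b k Fin.< a k)

  extremal-beyond : ∀ dir S a b → Extremal dir S a → S b → (a ≐ b) ⊎ Beyond dir a b
  extremal-beyond true S a b (_ , least) b∈S with least b b∈S
  ... | inj₁ a≐b = inj₁ a≐b
  ... | inj₂ (k , agree , cmp) = inj₂ (k , agree , cmpAt-view (g (pref a k)) (a k) (b k) cmp)
  extremal-beyond false S a b (_ , greatest) b∈S with greatest b b∈S
  ... | inj₁ a≐b = inj₁ a≐b
  ... | inj₂ (k , agree , cmp) with cmpAt-view (g (pref b k)) (b k) (a k) cmp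
  ...   | above , below = inj₂ (k , (λ i i<k → sym (agree i i<k)) ,
                                    (λ e → below (trans same-parity e)) ,
                                    (λ e → above (trans same-parity e)))
    where
    same-parity : parity b k ≡ parity a k
    same-parity = cong (λ w → evenb (g w)) (pref-cong b a k agree)

  beyond-differs : ∀ dir (a b : InfWord Q) k → (parity a k ≡ dir → a k Fin.< b k) →
    (parity a k ≡ not dir → b k Fin.< a k) → ¬ a k ≡ b k
  beyond-differs dir a b k above below ak≡bk with bool-split (parity a k) dir
  ... | inj₁ e = <-irrefl (cong toℕ ak≡bk) (above e)
  ... | inj₂ e = <-irrefl (cong toℕ (sym ak≡bk)) (below e)

  q-2 : Fin Q
  q-2 = Fin.inject₁ (Fin.fromℕ r)

  toℕ-q-2 : toℕ q-2 ≡ r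
  toℕ-q-2 = trans (Finₚ.toℕ-inject₁ (Fin.fromℕ r)) (Finₚ.toℕ-fromℕ r)

  q-2-not-top : ¬ toℕ q-2 ≡ suc r
  q-2-not-top e = 1+n≢n (sym (trans (sym toℕ-q-2) e))

  module Extremal-word (dir : Bool) (f p : Word Q) (a : InfWord Q) (ends : EndsWithTop Q f)
    (extremal : Extremal dir (InPF f p) a) (not-ultimately-zero : ¬ UltPeriod0 a) where

    a∈S : InPF f p a
    a∈S = extremal-member dir (InPF f p) a extremal

    splice-admissible : ∀ m c → length p ≤ m → ¬ toℕ c ≡ suc r → InPF f p (splice a m c)
    splice-admissible m c |p|≤m c-not-top = has-prefix , avoids
      where
      has-prefix : HasPrefix p (splice a m c)
      has-prefix = trans (pref-cong (splice a m c) a (length p)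
                           (λ i i<|p| → splice-below a m c i (<-≤-trans i<|p| |p|≤m)))
                         (proj₁ a∈S)
      tail-not-top : ∀ j → m ≤ j → ¬ toℕ (splice a m c j) ≡ suc r
      tail-not-top j m≤j with m≤n⇒m<n∨m≡n m≤j
      ... | inj₁ m<j = λ top → 0≢1+n (trans (sym (cong toℕ (splice-above a m c j m<j))) top)
      ... | inj₂ refl = λ top → c-not-top (trans (sym (cong toℕ (splice-at a m c))) top)
      avoids : AvoidsInf f (splice a m c)
      avoids = avoids-transfer f a (splice a m c) m ends (proj₂ a∈S) (splice-below a m c) tail-not-top

    splice-beyond : ∀ m c → length p ≤ m → ¬ toℕ c ≡ suc r →
      ∃ λ k → m ≤ k × (∀ i → i < k → a i ≡ splice a m c i) ×
        (parity a k ≡ dir → a k Fin.< splice a m c k) × (parity a k ≡ not dir → splice a m c k Fin.< a k)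
    splice-beyond m c |p|≤m c-not-top
      with extremal-beyond dir (InPF f p) a (splice a m c) extremal (splice-admissible m c |p|≤m c-not-top)
    ... | inj₁ a≐b = ⊥-elim (not-ultimately-zero (≐-ultimately-zero a≐b (splice-ultimately-zero a m c)))
    ... | inj₂ (k , agree , above , below) with k <? m
    ...   | yes k<m = ⊥-elim (beyond-differs dir a (splice a m c) k above below (sym (splice-below a m c k k<m)))
    ...   | no k≮m = k , ≮⇒≥ k≮m , agree , above , below

    -- From |p| on, the prefix parity of a is never dir: otherwise the
    -- truncation a[0,m) 0^∞ would lie beyond a, with a symbol below 0.
    tail-parity : ∀ m → length p ≤ m → parity a m ≡ not dir
    tail-parity m |p|≤m with bool-split (parity a m) dir
    ... | inj₂ e = e
    ... | inj₁ e with splice-beyond m Fin.zero |p|≤m (λ ())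
    ...   | k , m≤k , agree , above , _ =
      ⊥-elim (n≮0 (subst (λ x → toℕ (a k) < toℕ x) (truncate-zero a m k m≤k) (above parity-k)))
      where
      parity-k : parity a k ≡ dir
      parity-k = trans (cong evenb (weight-zeros a m k m≤k
                   (λ j m≤j j<k → trans (agree j j<k) (truncate-zero a m j m≤j)))) e

    -- No tail symbol of a is q-1, since it would flip the parity to dir.
    tail-not-top : ∀ i → length p ≤ i → ¬ toℕ (a i) ≡ suc r
    tail-not-top i |p|≤i top = not-¬ flipped (tail-parity (suc i) (m≤n⇒m≤1+n |p|≤i))
      where
      flipped : parity a (suc i) ≡ dir
      flipped = begin
        parity a (suc i)        ≡⟨ parity-top a i top ⟩
        not (parity a i)        ≡⟨ cong not (tail-parity i |p|≤i) ⟩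
        not (not dir)           ≡⟨ not-involutive dir ⟩
        dir                     ∎

    -- Every tail symbol is q-2: compare a with a[0,i) (q-2) 0^∞.  A first
    -- difference at i would need q-2 < a i, i.e. a i = q-1.
    tail-symbol : ∀ i → length p ≤ i → toℕ (a i) ≡ r
    tail-symbol i |p|≤i with splice-beyond i q-2 |p|≤i q-2-not-top
    ... | k , i≤k , agree , above , below with m≤n⇒m<n∨m≡n i≤k
    ...   | inj₁ i<k = begin
      toℕ (a i)                 ≡⟨ cong toℕ (agree i i<k) ⟩
      toℕ (splice a i q-2 i)    ≡⟨ cong toℕ (splice-at a i q-2) ⟩
      toℕ q-2                   ≡⟨ toℕ-q-2 ⟩
      r                         ∎
    ...   | inj₂ refl = ⊥-elim (tail-not-top i |p|≤i (≤-antisym (s≤s⁻¹ (Finₚ.toℕ<n (a i))) r<ai))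
      where
      r<ai : r < toℕ (a i)
      r<ai = subst (_< toℕ (a i)) (trans (cong toℕ (splice-at a i q-2)) toℕ-q-2)
                   (below (tail-parity i |p|≤i))

  extremal-tail : ∀ f p a → EndsWithTop Q f →
    Extremal true (InPF f p) a ⊎ Extremal false (InPF f p) a → ¬ UltPeriod0 a →
    HasPrefix p a × (∀ i → length p ≤ i → toℕ (a i) ≡ r)
  extremal-tail f p a ends (inj₁ least) not-zero =
    let open Extremal-word true f p a ends least not-zero in proj₁ a∈S , tail-symbol
  extremal-tail f p a ends (inj₂ greatest) not-zero =
    let open Extremal-word false f p a ends greatest not-zero in proj₁ a∈S , tail-symbol

symsum-snoc : ∀ {q} (xs : Word q) x → symsum (xs ++ [ x ]) ≡ symsum xs + toℕ x
symsum-snoc xs x = begin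
  sum (map toℕ (xs ++ [ x ]))        ≡⟨ cong sum (map-++ toℕ xs [ x ]) ⟩
  sum (map toℕ xs ++ [ toℕ x ])      ≡⟨ sum-++ (map toℕ xs) [ toℕ x ] ⟩
  symsum xs + (toℕ x + 0)            ≡⟨ cong (symsum xs +_) (+-identityʳ (toℕ x)) ⟩
  symsum xs + toℕ x                  ∎

nonzero : ∀ {q} → Fin q → ℕ
nonzero Fin.zero = 0
nonzero (Fin.suc _) = 1

nonzeros-snoc : ∀ {q} (xs : Word q) x → nonzeros (xs ++ [ x ]) ≡ nonzeros xs + nonzero x
nonzeros-snoc [] Fin.zero = refl
nonzeros-snoc [] (Fin.suc x) = refl
nonzeros-snoc (Fin.zero ∷ xs) x = nonzeros-snoc xs x
nonzeros-snoc (Fin.suc _ ∷ xs) x = cong suc (nonzeros-snoc xs x)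

triWeight : ∀ {q} → Word q → ℕ
triWeight w = symsum w + nonzeros w

triSymbol : ∀ {q} → Fin q → ℕ
triSymbol x = toℕ x + nonzero x

triWeight-snoc : ∀ {q} (xs : Word q) x → triWeight (xs ++ [ x ]) ≡ triWeight xs + triSymbol x
triWeight-snoc xs x = begin
  symsum (xs ++ [ x ]) + nonzeros (xs ++ [ x ])       ≡⟨ cong₂ _+_ (symsum-snoc xs x) (nonzeros-snoc xs x) ⟩
  (symsum xs + toℕ x) + (nonzeros xs + nonzero x)     ≡⟨ interchange (symsum xs) (toℕ x) (nonzeros xs) (nonzero x) ⟩
  triWeight xs + triSymbol x                          ∎

even-top-odd : ∀ n → evenb (suc n) ≡ true → evenb n ≡ false
even-top-odd n even = begin
  evenb n                 ≡⟨ not-involutive (evenb n) ⟨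
  not (not (evenb n))     ≡⟨ cong not (trans (sym (evenb-suc n)) even) ⟩
  false                   ∎

odd-top-odd : ∀ n (x : Fin (suc (suc n))) → toℕ x ≡ suc n → evenb (suc (suc n)) ≡ false →
  evenb (triSymbol x) ≡ false
odd-top-odd n (Fin.suc y) top odd = begin
  evenb (toℕ (Fin.suc y) + 1)   ≡⟨ cong (λ m → evenb (m + 1)) top ⟩
  evenb (suc n + 1)             ≡⟨ cong evenb (+-comm (suc n) 1) ⟩
  evenb (suc (suc n))           ≡⟨ odd ⟩
  false                         ∎

proposition5 : (q : ℕ) → 3 ≤ q → (f : Word q) → EndsWithTop q f →
    ¬ InducesZeroPeriodicity q f →
    (p : Word q) → AvoidsFin f p → (a : InfWord q) →
    (IsFirst q (InPF f p) a ⊎ IsLast q (InPF f p) a) → ¬ UltPeriod0 a →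
    HasPrefix p a × (∀ i → length p ≤ i → toℕ (a i) ≡ q ∸ 2)
proposition5 (suc (suc (suc r))) (s≤s (s≤s (s≤s z≤n))) f ends _ p _ a extremal not-zero
  with evenb (suc (suc (suc r))) in q-parity
... | true = extremal-tail f p a ends extremal not-zero
  where
  open ExtremalWords (suc r) symsum toℕ symsum-snoc refl
    (λ x top → trans (cong evenb top) (even-top-odd (suc (suc r)) q-parity))
... | false = extremal-tail f p a ends extremal not-zero
  where
  open ExtremalWords (suc r) triWeight triSymbol triWeight-snoc refl
    (λ x top → odd-top-odd (suc r) x top q-parity)
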